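{- Let $d$ and $p$ be fixed, let $M$ be a matroid on $n$ elements, and let $W=\sum_{k=1}^p a_k\delta^k\in\mathbb{Z}^{d\times n}$ be given in generalized unary encoding. Then $\#W\mathcal{P}_M$ is bounded by a polynomial in $n$, the binary encoding lengths of the $a_k$, and the unary encodings of the $\delta^k$, $1\le k\le p$.
   Context: Generalized unary encoding: $W$ is given as $W=\sum_{k=1}^p a_k\delta^k$ where $a_1,\dots,a_p$ are distinct positive integers encoded in binary and $\delta^1,\dots,\delta^p\in\mathbb{Z}^{d\times n}$ are integer matrices encoded in unary. For a matroid $M$ on $[n]$ with bases $\mathcal{B}_M$, $W\mathcal{P}_M:=\{W\mathbf{e}_B:B\in\mathcal{B}_M\}\subseteq\mathbb{R}^d$ with $\mathbf{e}_B=\sum_{i\in B}\mathbf{e}_i$, and $\#W\mathcal{P}_M$ denotes its cardinality. -}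

module Defs where

open import Data.Nat using (ℕ; zero; suc; _+_; _*_; _^_; _≤_; _<_)
open import Data.Nat.Logarithm using (⌊log₂_⌋)
open import Data.Integer as ℤ using (ℤ; +_; ∣_∣)
open import Data.Integer.Properties as ℤP using ()
open import Data.Bool using (Bool; true; false; if_then_else_)
open import Data.Fin using (Fin; zero; suc)
open import Data.Fin.Subset using (Subset; _∈_; _∉_; _-_; _∪_; ⁅_⁆)
open import Data.Vec using (Vec; []; _∷_; tabulate; lookup)
open import Data.Vec.Properties using (≡-dec)
open import Data.List using (List; []; _∷_; map; length; filter; deduplicate; _++_)
open import Data.Product using (Σ; ∃; _×_; _,_)
open import Relation.Binary.PropositionalEquality using (_≡_)
open import Relation.Nullary.Decidable using (does)
open import Data.Bool using (T?)

sumℕ : (m : ℕ) → (Fin m → ℕ) → ℕ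
sumℕ zero    f = 0
sumℕ (suc m) f = f zero + sumℕ m (λ i → f (suc i))

sumℤ : (m : ℕ) → (Fin m → ℤ) → ℤ
sumℤ zero    f = + 0
sumℤ (suc m) f = f zero ℤ.+ sumℤ m (λ i → f (suc i))

-- Matroid on ground set [n] = Fin n, given by its set of bases
-- (decidable, as a Bool-valued predicate on subsets) satisfying the basis axioms.
record Matroid (n : ℕ) : Set where
  field
    isBasis  : Subset n → Bool
    nonempty : ∃ λ B → isBasis B ≡ true
    exchange : ∀ B₁ B₂ → isBasis B₁ ≡ true → isBasis B₂ ≡ true →
               ∀ x → x ∈ B₁ → x ∉ B₂ →
               ∃ λ y → y ∈ B₂ × y ∉ B₁ × isBasis ((B₁ - x) ∪ ⁅ y ⁆) ≡ true
open Matroid public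

allSubsets : (n : ℕ) → List (Subset n)
allSubsets zero    = [] ∷ []
allSubsets (suc n) = map (true ∷_) (allSubsets n) ++ map (false ∷_) (allSubsets n)

bases : ∀ {n} → Matroid n → List (Subset n)
bases {n} M = filter (λ B → T? (isBasis M B)) (allSubsets n)

genMatrix : ∀ {d n p} → (Fin p → ℕ) → (Fin p → Fin d → Fin n → ℤ) → Fin d → Fin n → ℤ
genMatrix {p = p} a δ i j = sumℤ p (λ k → + a k ℤ.* δ k i j)

applyIndicator : ∀ {d n} → (Fin d → Fin n → ℤ) → Subset n → Vec ℤ d
applyIndicator {n = n} W B =
  tabulate (λ i → sumℤ n (λ j → if lookup B j then W i j else + 0))

-- #WP_M : number of distinct vectors W e_B, B a basis of M
cardWP : ∀ {d n} → (Fin d → Fin n → ℤ) → Matroid n → ℕ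
cardWP W M = length (deduplicate (≡-dec ℤ._≟_) (map (applyIndicator W) (bases M)))

binLen : ℕ → ℕ
binLen a = suc ⌊log₂ a ⌋

unarySize : ∀ {d n} → (Fin d → Fin n → ℤ) → ℕ
unarySize {d} {n} δ = sumℕ d (λ i → sumℕ n (λ j → suc ∣ δ i j ∣))

inputSize : ∀ {d n p} → (Fin p → ℕ) → (Fin p → Fin d → Fin n → ℤ) → ℕ
inputSize {n = n} {p = p} a δ = n + sumℕ p (λ k → binLen (a k)) + sumℕ p (λ k → unarySize (δ k))

module Submission where

-- Write  δᵏ e_B  for the vector of row sums of δᵏ restricted
-- to the columns in B.  Since e_B is fixed, W e_B is linear in W, so
--   W e_B = Σ_k a_k · δᵏ e_B .
-- Hence W e_B is determined by the "profile" (δ¹ e_B, …, δᵖ e_B), an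
-- integer p×d array whose entries are bounded in absolute value by the
-- unary size of the δᵏ, hence by the input size S.  There are at most
-- (2S+1)^(dp) ≤ (S+1)^(2dp) such arrays, so #W𝒫_M ≤ (S+1)^(2dp): the
-- theorem holds with c = 1 and e = 2dp, which depend on d and p only.

open import Defs
open import Data.Nat using (ℕ; zero; suc; _+_; _*_; _^_; _≤_; _<_; z≤n; s≤s)
import Data.Nat.Properties as ℕP
open import Data.Integer as ℤ using (ℤ; +_; -[1+_]; ∣_∣)
import Data.Integer.Properties as ℤP
open import Data.Bool using (Bool; true; false; if_then_else_)
open import Data.Fin using (Fin; zero; suc)
open import Data.Fin.Subset using (Subset)
open import Data.Vec using (Vec; []; _∷_; tabulate; lookup)
open import Data.Vec.Properties using (≡-dec; lookup∘tabulate; tabulate-cong)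
open import Data.List
  using (List; []; _∷_; map; length; _++_; upTo; deduplicate; cartesianProductWith)
open import Data.List.Properties using (length-map; length-++; length-upTo; length-removeAt′)
open import Data.List.Relation.Unary.Any using (here; there; _─_)
import Data.List.Relation.Unary.Any.Properties as AnyP
open import Data.List.Relation.Unary.All using (All; _∷_)
open import Data.List.Relation.Unary.AllPairs using (_∷_)
open import Data.List.Relation.Unary.Unique.Propositional using (Unique)
open import Data.List.Relation.Unary.Unique.DecPropositional.Properties using (deduplicate-!)
open import Data.List.Membership.Propositional using (_∈_)
open import Data.List.Membership.Propositional.Properties
  using (∈-map⁺; ∈-map⁻; ∈-++⁺ˡ; ∈-++⁺ʳ; ∈-upTo⁺; ∈-deduplicate⁻)
open import Data.Product using (∃₂; _,_)
open import Relation.Binary using (DecidableEquality)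
open import Relation.Binary.PropositionalEquality
  using (_≡_; _≢_; refl; sym; trans; cong; cong₂; subst; module ≡-Reasoning)
open import Relation.Nullary using (contradiction)
open import Function.Definitions using (Injective)
open import Algebra.Properties.Semiring.Sum ℤP.+-*-semiring
  using (sum; ∑-comm; *-distribˡ-sum; sum-cong-≗; sum-replicate-zero)

∈-─⁺ : ∀ {A : Set} {x y : A} {ys : List A} (x∈ys : x ∈ ys) →
       y ∈ ys → x ≢ y → y ∈ (ys ─ x∈ys)
∈-─⁺ (here refl) (here refl) x≢y = contradiction refl x≢y
∈-─⁺ (here refl) (there y∈ys) _   = y∈ys
∈-─⁺ (there _)   (here refl)  _   = here refl
∈-─⁺ (there x∈ys) (there y∈ys) x≢y = there (∈-─⁺ x∈ys y∈ys x≢y)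

unique-⊆⇒length≤ : ∀ {A : Set} (xs ys : List A) → Unique xs →
                   (∀ {z} → z ∈ xs → z ∈ ys) → length xs ≤ length ys
unique-⊆⇒length≤ []       ys _ _ = z≤n
unique-⊆⇒length≤ (x ∷ xs) ys (x∉xs ∷ uxs) xs⊆ys =
  subst (suc (length xs) ≤_) (sym (length-removeAt′ ys _))
    (s≤s (unique-⊆⇒length≤ xs (ys ─ x∈ys) uxs
      (λ z∈xs → ∈-─⁺ x∈ys (xs⊆ys (there z∈xs)) (differs x∉xs z∈xs))))
  where
  x∈ys = xs⊆ys (here refl)
  differs : ∀ {zs z} → All (x ≢_) zs → z ∈ zs → x ≢ z
  differs (x≢z ∷ _)   (here refl) = x≢z
  differs (_ ∷ x≢zs) (there z∈zs) = differs x≢zs z∈zs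

#distinctImages≤ : ∀ {A B : Set} (_≟_ : DecidableEquality B) (f : A → B)
                   (xs : List A) (ys : List B) → (∀ x → f x ∈ ys) →
                   length (deduplicate _≟_ (map f xs)) ≤ length ys
#distinctImages≤ _≟_ f xs ys f∈ys =
  unique-⊆⇒length≤ _ ys (deduplicate-! _≟_ (map f xs)) image⊆ys
  where
  image⊆ys : ∀ {y} → y ∈ deduplicate _≟_ (map f xs) → y ∈ ys
  image⊆ys y∈ with x , _ , refl ← ∈-map⁻ f (∈-deduplicate⁻ _≟_ (map f xs) y∈) = f∈ys x

intsWithin : ℕ → List ℤ
intsWithin S = map +_ (upTo (suc S)) ++ map -[1+_] (upTo S)

length-intsWithin : ∀ S → length (intsWithin S) ≡ suc S + S
length-intsWithin S = begin
  length (intsWithin S)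
    ≡⟨ length-++ (map +_ (upTo (suc S))) ⟩
  length (map +_ (upTo (suc S))) + length (map -[1+_] (upTo S))
    ≡⟨ cong₂ _+_ (length-map +_ (upTo (suc S))) (length-map -[1+_] (upTo S)) ⟩
  length (upTo (suc S)) + length (upTo S)
    ≡⟨ cong₂ _+_ (length-upTo (suc S)) (length-upTo S) ⟩
  suc S + S ∎
  where open ≡-Reasoning

∈-intsWithin : ∀ S (z : ℤ) → ∣ z ∣ ≤ S → z ∈ intsWithin S
∈-intsWithin S (+ m)    m≤S = ∈-++⁺ˡ (∈-map⁺ +_ (∈-upTo⁺ (s≤s m≤S)))
∈-intsWithin S -[1+ m ] m<S = ∈-++⁺ʳ (map +_ (upTo (suc S))) (∈-map⁺ -[1+_] (∈-upTo⁺ m<S))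

length-cartesianProductWith : ∀ {A B C : Set} (f : A → B → C) xs ys →
  length (cartesianProductWith f xs ys) ≡ length xs * length ys
length-cartesianProductWith f []       ys = refl
length-cartesianProductWith f (x ∷ xs) ys =
  trans (length-++ (map (f x) ys))
        (cong₂ _+_ (length-map (f x) ys) (length-cartesianProductWith f xs ys))

vecsOver : ∀ {A : Set} → List A → (k : ℕ) → List (Vec A k)
vecsOver xs zero    = [] ∷ []
vecsOver xs (suc k) = cartesianProductWith _∷_ xs (vecsOver xs k)

length-vecsOver : ∀ {A : Set} (xs : List A) k → length (vecsOver xs k) ≡ length xs ^ k
length-vecsOver xs zero    = refl
length-vecsOver xs (suc k) =
  trans (length-cartesianProductWith _∷_ xs (vecsOver xs k))
        (cong (length xs *_) (length-vecsOver xs k))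

∈-vecsOver : ∀ {A : Set} (xs : List A) k (f : Fin k → A) →
             (∀ i → f i ∈ xs) → tabulate f ∈ vecsOver xs k
∈-vecsOver xs zero    f f∈xs = here refl
∈-vecsOver xs (suc k) f f∈xs =
  AnyP.cartesianProductWith⁺ _∷_ (λ { refl refl → refl })
    (f∈xs zero) (∈-vecsOver xs k (λ i → f (suc i)) (λ i → f∈xs (suc i)))

-- sumℤ is the semiring summation of the standard library, whose
-- interchange and distributivity laws are used below.
sumℤ≡sum : ∀ m (f : Fin m → ℤ) → sumℤ m f ≡ sum f
sumℤ≡sum zero    f = refl
sumℤ≡sum (suc m) f = cong (λ t → f zero ℤ.+ t) (sumℤ≡sum m (λ i → f (suc i)))

∣sumℤ∣≤sumℕ∣∣ : ∀ m (f : Fin m → ℤ) → ∣ sumℤ m f ∣ ≤ sumℕ m (λ i → ∣ f i ∣)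
∣sumℤ∣≤sumℕ∣∣ zero    f = z≤n
∣sumℤ∣≤sumℕ∣∣ (suc m) f =
  ℕP.≤-trans (ℤP.∣i+j∣≤∣i∣+∣j∣ (f zero) _)
             (ℕP.+-monoʳ-≤ ∣ f zero ∣ (∣sumℤ∣≤sumℕ∣∣ m (λ i → f (suc i))))

sumℕ-mono : ∀ m {f g : Fin m → ℕ} → (∀ i → f i ≤ g i) → sumℕ m f ≤ sumℕ m g
sumℕ-mono zero    f≤g = z≤n
sumℕ-mono (suc m) f≤g = ℕP.+-mono-≤ (f≤g zero) (sumℕ-mono m (λ i → f≤g (suc i)))

term≤sumℕ : ∀ m (f : Fin m → ℕ) i → f i ≤ sumℕ m f
term≤sumℕ (suc m) f zero    = ℕP.m≤m+n (f zero) _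
term≤sumℕ (suc m) f (suc i) =
  ℕP.≤-trans (term≤sumℕ m (λ k → f (suc k)) i) (ℕP.m≤n+m _ (f zero))

select : Bool → ℤ → ℤ
select b x = if b then x else + 0

selectedRowSum : ∀ {d n} → (Fin d → Fin n → ℤ) → Subset n → Fin d → ℤ
selectedRowSum {n = n} W B i = sumℤ n (λ j → select (lookup B j) (W i j))

select-linear : ∀ p (c : Fin p → ℤ) (x : Fin p → ℤ) b →
  select b (sumℤ p (λ k → c k ℤ.* x k)) ≡ sumℤ p (λ k → c k ℤ.* select b (x k))
select-linear p c x true  = refl
select-linear p c x false = begin
  + 0                                ≡⟨ sym (sum-replicate-zero p) ⟩
  sum (λ (_ : Fin p) → + 0)          ≡⟨ sum-cong-≗ (λ k → ℤP.*-zeroʳ (c k)) ⟨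
  sum (λ k → c k ℤ.* + 0)            ≡⟨ sumℤ≡sum p _ ⟨
  sumℤ p (λ k → c k ℤ.* + 0)         ∎
  where open ≡-Reasoning

selectedRowSum-linear : ∀ {d n p} (a : Fin p → ℕ) (δ : Fin p → Fin d → Fin n → ℤ) B i →
  selectedRowSum (genMatrix a δ) B i ≡ sumℤ p (λ k → + a k ℤ.* selectedRowSum (δ k) B i)
selectedRowSum-linear {n = n} {p} a δ B i = begin
  sumℤ n (λ j → select (lookup B j) (sumℤ p (λ k → + a k ℤ.* δ k i j)))
    ≡⟨ sumℤ≡sum n _ ⟩
  sum (λ j → select (lookup B j) (sumℤ p (λ k → + a k ℤ.* δ k i j)))
    ≡⟨ sum-cong-≗ (λ j → trans (select-linear p (λ k → + a k) (λ k → δ k i j) (lookup B j))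
                               (sumℤ≡sum p _)) ⟩
  sum (λ j → sum (λ k → + a k ℤ.* select (lookup B j) (δ k i j)))
    ≡⟨ ∑-comm (λ j k → + a k ℤ.* select (lookup B j) (δ k i j)) ⟩
  sum (λ k → sum (λ j → + a k ℤ.* select (lookup B j) (δ k i j)))
    ≡⟨ sum-cong-≗ (λ k → *-distribˡ-sum (+ a k) (λ j → select (lookup B j) (δ k i j))) ⟨
  sum (λ k → + a k ℤ.* sum (λ j → select (lookup B j) (δ k i j)))
    ≡⟨ sum-cong-≗ (λ k → cong (+ a k ℤ.*_) (sumℤ≡sum n _)) ⟨
  sum (λ k → + a k ℤ.* selectedRowSum (δ k) B i)
    ≡⟨ sumℤ≡sum p _ ⟨
  sumℤ p (λ k → + a k ℤ.* selectedRowSum (δ k) B i) ∎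
  where open ≡-Reasoning

∣selectedRowSum∣≤unarySize : ∀ {d n} (δ : Fin d → Fin n → ℤ) B i →
                             ∣ selectedRowSum δ B i ∣ ≤ unarySize δ
∣selectedRowSum∣≤unarySize {d} {n} δ B i = begin
  ∣ selectedRowSum δ B i ∣               ≤⟨ ∣sumℤ∣≤sumℕ∣∣ n _ ⟩
  sumℕ n (λ j → ∣ select (lookup B j) (δ i j) ∣)
                                         ≤⟨ sumℕ-mono n (λ j → ∣select∣≤ (lookup B j) (δ i j)) ⟩
  sumℕ n (λ j → suc ∣ δ i j ∣)           ≤⟨ term≤sumℕ d (λ i → sumℕ n (λ j → suc ∣ δ i j ∣)) i ⟩
  unarySize δ                            ∎
  where
  open ℕP.≤-Reasoning
  ∣select∣≤ : ∀ b x → ∣ select b x ∣ ≤ suc ∣ x ∣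
  ∣select∣≤ true  x = ℕP.n≤1+n _
  ∣select∣≤ false x = z≤n

unarySize≤inputSize : ∀ {d n p} (a : Fin p → ℕ) (δ : Fin p → Fin d → Fin n → ℤ) k →
                      unarySize (δ k) ≤ inputSize a δ
unarySize≤inputSize {n = n} {p} a δ k =
  ℕP.≤-trans (term≤sumℕ p (λ k → unarySize (δ k)) k)
             (ℕP.m≤n+m _ (n + sumℕ p (λ k → binLen (a k))))

module Profiles {d n p : ℕ} (a : Fin p → ℕ) (δ : Fin p → Fin d → Fin n → ℤ) where

  profile : Subset n → Vec (Vec ℤ d) p
  profile B = tabulate (λ k → applyIndicator (δ k) B)

  combine : Vec (Vec ℤ d) p → Vec ℤ d
  combine v = tabulate (λ i → sumℤ p (λ k → + a k ℤ.* lookup (lookup v k) i))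

  applyIndicator≡combine∘profile : ∀ B →
    applyIndicator (genMatrix a δ) B ≡ combine (profile B)
  applyIndicator≡combine∘profile B = tabulate-cong λ i → begin
    selectedRowSum (genMatrix a δ) B i
      ≡⟨ selectedRowSum-linear a δ B i ⟩
    sumℤ p (λ k → + a k ℤ.* selectedRowSum (δ k) B i)
      ≡⟨ sumℤ≡sum p _ ⟩
    sum (λ k → + a k ℤ.* selectedRowSum (δ k) B i)
      ≡⟨ sum-cong-≗ (λ k → cong (+ a k ℤ.*_) (profile-entry k i)) ⟨
    sum (λ k → + a k ℤ.* lookup (lookup (profile B) k) i)
      ≡⟨ sumℤ≡sum p _ ⟨
    sumℤ p (λ k → + a k ℤ.* lookup (lookup (profile B) k) i) ∎
    where
    open ≡-Reasoning
    profile-entry : ∀ k i → lookup (lookup (profile B) k) i ≡ selectedRowSum (δ k) B i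
    profile-entry k i = trans (cong (λ v → lookup v i) (lookup∘tabulate _ k))
                              (lookup∘tabulate _ i)

  boundedProfiles : List (Vec (Vec ℤ d) p)
  boundedProfiles = vecsOver (vecsOver (intsWithin (inputSize a δ)) d) p

  profile∈boundedProfiles : ∀ B → profile B ∈ boundedProfiles
  profile∈boundedProfiles B =
    ∈-vecsOver _ p _ λ k → ∈-vecsOver _ d _ λ i →
      ∈-intsWithin _ _ (ℕP.≤-trans (∣selectedRowSum∣≤unarySize (δ k) B i)
                                   (unarySize≤inputSize a δ k))

  length-boundedProfiles : length boundedProfiles ≤ suc (inputSize a δ) ^ (2 * d * p)
  length-boundedProfiles = begin
    length boundedProfiles                  ≡⟨ length-vecsOver _ p ⟩
    length (vecsOver ints d) ^ p            ≡⟨ cong (_^ p) (length-vecsOver ints d) ⟩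
    (length ints ^ d) ^ p                   ≡⟨ cong (λ t → (t ^ d) ^ p) (length-intsWithin S) ⟩
    ((suc S + S) ^ d) ^ p                   ≤⟨ ℕP.^-monoˡ-≤ p (ℕP.^-monoˡ-≤ d 2S+1≤[S+1]²) ⟩
    ((suc S ^ 2) ^ d) ^ p                   ≡⟨ cong (_^ p) (ℕP.^-*-assoc (suc S) 2 d) ⟩
    (suc S ^ (2 * d)) ^ p                   ≡⟨ ℕP.^-*-assoc (suc S) (2 * d) p ⟩
    suc S ^ (2 * d * p)                     ∎
    where
    open ℕP.≤-Reasoning
    S = inputSize a δ
    ints = intsWithin S
    2S+1≤[S+1]² : suc S + S ≤ suc S ^ 2
    2S+1≤[S+1]² = subst (suc S + S ≤_) (cong (suc S *_) (sym (ℕP.*-identityʳ (suc S))))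
                        (ℕP.+-monoʳ-≤ (suc S) (ℕP.m≤m*n S (suc S)))

-- #W𝒫_M ≤ 1 · (S+1)^(2dp).  The bound does not need the hypotheses that
-- the a_k are distinct and positive.
mainTheorem17 : ∀ (d p : ℕ) → ∃₂ λ (c e : ℕ) →
    ∀ (n : ℕ) (M : Matroid n) (a : Fin p → ℕ) (δ : Fin p → Fin d → Fin n → ℤ) →
    Injective _≡_ _≡_ a → (∀ k → 0 < a k) →
    cardWP (genMatrix a δ) M ≤ c * (suc (inputSize a δ)) ^ e
mainTheorem17 d p = 1 , 2 * d * p , λ n M a δ _ _ →
  let open Profiles a δ in
  begin
    cardWP (genMatrix a δ) M
      ≤⟨ #distinctImages≤ (≡-dec ℤ._≟_) (applyIndicator (genMatrix a δ)) (bases M)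
           (map combine boundedProfiles)
           (λ B → subst (_∈ map combine boundedProfiles)
                        (sym (applyIndicator≡combine∘profile B))
                        (∈-map⁺ combine (profile∈boundedProfiles B))) ⟩
    length (map combine boundedProfiles)  ≡⟨ length-map combine boundedProfiles ⟩
    length boundedProfiles                ≤⟨ length-boundedProfiles ⟩
    suc (inputSize a δ) ^ (2 * d * p)     ≡⟨ ℕP.*-identityˡ _ ⟨
    1 * suc (inputSize a δ) ^ (2 * d * p) ∎
  where open ℕP.≤-Reasoning
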